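{- For every graph $G=(V,E)$ on $n$ vertices, \[ n-2z(G)\le \iota(G)\le n-z(G). \]
   Context: For a graph $H$, $\kappa(H)$ denotes the largest number of vertices in a connected component of $H$ (with $\kappa$ of the empty graph equal to $0$). The integrity of a graph $G=(V,E)$ is $\iota(G)=\min_{S\subseteq V}\big(|S|+\kappa(G-S)\big)$, where $G-S$ is the graph obtained by deleting the vertices in $S$. $z(G)$ denotes the largest integer $z$ such that there exist two disjoint sets of vertices of $G$, each of size $z$, with no edge of $G$ between them. -}

module Defs where

open import Data.Nat using (ℕ; _+_; _≤_)
open import Data.Bool using (Bool; true; false)
open import Data.Fin using (Fin)
open import Data.Fin.Subset using (Subset; _∈_; _∉_; ∣_∣)
open import Data.Product using (Σ; ∃; ∃-syntax; _×_; _,_)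
open import Data.Sum using (_⊎_)
open import Data.Empty using (⊥)
open import Relation.Binary.PropositionalEquality using (_≡_)
open import Function.Bundles using (_⇔_)

record Graph (n : ℕ) : Set where
  field
    adj    : Fin n → Fin n → Bool
    sym    : ∀ u v → adj u v ≡ adj v u
    irrefl : ∀ v → adj v v ≡ false
open Graph public

-- Reach G S v u : u is reachable from v by a walk in G - S
-- (all vertices of the walk lie outside S).
data Reach {n : ℕ} (G : Graph n) (S : Subset n) (v : Fin n) : Fin n → Set where
  here : v ∉ S → Reach G S v v
  step : ∀ {u w} → Reach G S v u → adj G u w ≡ true → w ∉ S → Reach G S v w

IsComponentOf : {n : ℕ} → Graph n → Subset n → Fin n → Subset n → Set
IsComponentOf G S v C = v ∉ S × (∀ u → (u ∈ C ⇔ Reach G S v u))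

IsKappa : {n : ℕ} → Graph n → Subset n → ℕ → Set
IsKappa {n} G S k =
  (∀ (v : Fin n) (C : Subset n) → IsComponentOf G S v C → ∣ C ∣ ≤ k)
  × ((k ≡ 0 × (∀ (v : Fin n) → v ∈ S))
     ⊎ (∃[ v ] ∃[ C ] (IsComponentOf G S v C × ∣ C ∣ ≡ k)))

IsIntegrity : {n : ℕ} → Graph n → ℕ → Set
IsIntegrity {n} G i =
  (∃[ S ] ∃[ k ] (IsKappa G S k × ∣ S ∣ + k ≡ i))
  × (∀ (S : Subset n) (k : ℕ) → IsKappa G S k → i ≤ ∣ S ∣ + k)

Disjoint : {n : ℕ} → Subset n → Subset n → Set
Disjoint {n} A B = ∀ (x : Fin n) → x ∈ A → x ∈ B → ⊥

NoEdgeBetween : {n : ℕ} → Graph n → Subset n → Subset n → Set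
NoEdgeBetween {n} G A B = ∀ (a b : Fin n) → a ∈ A → b ∈ B → adj G a b ≡ false

IsZ : {n : ℕ} → Graph n → ℕ → Set
IsZ {n} G z =
  (∃[ A ] ∃[ B ] (Disjoint A B × NoEdgeBetween G A B × ∣ A ∣ ≡ z × ∣ B ∣ ≡ z))
  × (∀ (A B : Subset n) (m : ℕ) → Disjoint A B → NoEdgeBetween G A B
       → ∣ A ∣ ≡ m → ∣ B ∣ ≡ m → m ≤ z)

{-# OPTIONS --safe #-}
-- Upper bound: if A and B are disjoint non-adjacent z-sets, deleting the n - 2z vertices
-- outside A ∪ B leaves components that each lie inside A or inside B, so ι ≤ (n - 2z) + z.
-- Lower bound: let S attain ι and let k = κ(G - S). Adding whole components of G - S one at
-- a time, each of size at most k, we reach a union A of components such that both A and the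
-- rest B of G - S have at least (n - |S| - k)/2 vertices; as A and B are non-adjacent,
-- z ≥ (n - |S| - k)/2, i.e. n - 2z ≤ |S| + k = ι.
module Submission where

open import Defs hiding (sym)
open import Data.Nat using (ℕ; zero; suc; _+_; _∸_; _*_; _≤_; _<_; _⊓_; _⊔_; z≤n; s≤s; _≤?_)
open import Data.Nat.Properties
open import Algebra.Properties.CommutativeSemigroup +-commutativeSemigroup using (x∙yz≈y∙xz)
open import Data.Nat.Induction using (<-wellFounded)
open import Data.Nat.Tactic.RingSolver using (solve-∀)
open import Data.Product using (∃-syntax; _×_; _,_; proj₁; proj₂; uncurry)
open import Data.Sum using (_⊎_; inj₁; inj₂; [_,_]′)
import Data.Sum as Sum
open import Data.Bool using (true; false)
import Data.Bool.Properties as Bool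
open import Data.Fin using (Fin)
open import Data.Fin.Properties using (any?; all?)
open import Data.Vec using ([]; _∷_; here; there)
open import Data.Fin.Subset using (Subset; _∈_; _∉_; _⊆_; _⊂_; _∪_; _∩_; ∁; ⁅_⁆; ∣_∣)
  renaming (⊥ to ∅)
open import Data.Fin.Subset.Properties
  using ( _∈?_; ∉⊥; ⊥⊆; ∣⊥∣≡0; ∣p∣≤n; Empty-unique; p⊆q⇒∣p∣≤∣q∣; p⊂q⇒∣p∣<∣q∣; ∣∁p∣≡n∸∣p∣
        ; x∈⁅x⁆; x∈⁅y⁆⇒x≡y; x∈∁p⇒x∉p; x∉∁p⇒x∈p; x∉p⇒x∈∁p
        ; p⊆p∪q; x∈p∪q⁺; x∈p∪q⁻; x∈p∩q⁺; x∈p∩q⁻)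
open import Data.List using (List; []; _∷_; map; _++_; filter; cartesianProduct; allFin)
import Data.List.Membership.Propositional as List
open import Data.List.Membership.Propositional.Properties
  using (∈-++⁺ˡ; ∈-++⁺ʳ; ∈-map⁺; ∈-filter⁺; ∈-cartesianProduct⁺; ∈-allFin)
open import Data.List.Relation.Unary.All using (lookup)
import Data.List.Relation.Unary.Any as Any
open import Data.List.Relation.Unary.All.Properties using (all-filter)
open import Data.List.Extrema.Nat using (argmin; argmax; f[argmin]≤f[xs]; f[xs]≤f[argmax]; argmax-all)
open import Induction.WellFounded using (Acc; acc)
open import Relation.Binary.PropositionalEquality using (_≡_; refl; sym; trans; cong; cong₂; subst; module ≡-Reasoning)
open import Relation.Nullary using (Dec; yes; no; ¬?; contradiction)
open import Relation.Nullary.Decidable using (_×-dec_; _→-dec_; decidable-stable)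
open import Function.Bundles using (_⇔_; mk⇔; Equivalence)
open Equivalence using (to; from)
open import Function using (_∘_)

m+m≤n⇒n∸[m+m]+m≡n∸m : ∀ {m n} → m + m ≤ n → n ∸ (m + m) + m ≡ n ∸ m
m+m≤n⇒n∸[m+m]+m≡n∸m {m} {n} m+m≤n = begin-equality
  n ∸ (m + m) + m  ≡⟨ cong (_+ m) (sym (∸-+-assoc n m m)) ⟩
  n ∸ m ∸ m + m    ≡⟨ m∸n+n≡m (m+n≤o⇒m≤o∸n m m+m≤n) ⟩
  n ∸ m            ∎
  where open ≤-Reasoning

m≤n+o∧2n+o<p⇒2m≤p+o : ∀ {m n o p} → m ≤ n + o → 2 * n + o < p → 2 * m ≤ p + o
m≤n+o∧2n+o<p⇒2m≤p+o {m} {n} {o} {p} m≤n+o 2n+o<p = begin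
  2 * m            ≤⟨ *-monoʳ-≤ 2 m≤n+o ⟩
  2 * (n + o)      ≡⟨ regroup n o ⟩
  2 * n + o + o    ≤⟨ +-monoˡ-≤ o (<⇒≤ 2n+o<p) ⟩
  p + o            ∎
  where
  open ≤-Reasoning
  regroup : ∀ n o → 2 * (n + o) ≡ 2 * n + o + o
  regroup = solve-∀

m≤n+o∧2n≤m+k⇒m≤2o+k : ∀ {m n o k} → m ≤ n + o → 2 * n ≤ m + k → m ≤ 2 * o + k
m≤n+o∧2n≤m+k⇒m≤2o+k {m} {n} {o} {k} m≤n+o 2n≤m+k = +-cancelˡ-≤ m _ _ (begin
  m + m              ≤⟨ +-mono-≤ m≤n+o m≤n+o ⟩
  n + o + (n + o)    ≡⟨ regroup₁ n o ⟩
  2 * n + 2 * o      ≤⟨ +-monoˡ-≤ (2 * o) 2n≤m+k ⟩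
  m + k + 2 * o      ≡⟨ regroup₂ m k o ⟩
  m + (2 * o + k)    ∎)
  where
  open ≤-Reasoning
  regroup₁ : ∀ n o → n + o + (n + o) ≡ 2 * n + 2 * o
  regroup₁ = solve-∀
  regroup₂ : ∀ m k o → m + k + 2 * o ≡ m + (2 * o + k)
  regroup₂ = solve-∀

m≤2n+k∧m≤2o+k⇒m≤2[n⊓o]+k : ∀ {m n o k} → m ≤ 2 * n + k → m ≤ 2 * o + k → m ≤ 2 * (n ⊓ o) + k
m≤2n+k∧m≤2o+k⇒m≤2[n⊓o]+k {n = n} {o} m≤2n+k m≤2o+k with ⊓-sel n o
... | inj₁ n⊓o≡n rewrite n⊓o≡n = m≤2n+k
... | inj₂ n⊓o≡o rewrite n⊓o≡o = m≤2o+k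

∣p∪q∣+∣p∩q∣≡∣p∣+∣q∣ : ∀ {n} (p q : Subset n) → ∣ p ∪ q ∣ + ∣ p ∩ q ∣ ≡ ∣ p ∣ + ∣ q ∣
∣p∪q∣+∣p∩q∣≡∣p∣+∣q∣ []          []          = refl
∣p∪q∣+∣p∩q∣≡∣p∣+∣q∣ (true  ∷ p) (true  ∷ q) =
  cong suc (trans (+-suc _ _) (trans (cong suc (∣p∪q∣+∣p∩q∣≡∣p∣+∣q∣ p q)) (sym (+-suc _ _))))
∣p∪q∣+∣p∩q∣≡∣p∣+∣q∣ (true  ∷ p) (false ∷ q) = cong suc (∣p∪q∣+∣p∩q∣≡∣p∣+∣q∣ p q)
∣p∪q∣+∣p∩q∣≡∣p∣+∣q∣ (false ∷ p) (true  ∷ q) = trans (cong suc (∣p∪q∣+∣p∩q∣≡∣p∣+∣q∣ p q)) (sym (+-suc _ _))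
∣p∪q∣+∣p∩q∣≡∣p∣+∣q∣ (false ∷ p) (false ∷ q) = ∣p∪q∣+∣p∩q∣≡∣p∣+∣q∣ p q

∣p∪q∣≤∣p∣+∣q∣ : ∀ {n} (p q : Subset n) → ∣ p ∪ q ∣ ≤ ∣ p ∣ + ∣ q ∣
∣p∪q∣≤∣p∣+∣q∣ p q = subst (∣ p ∪ q ∣ ≤_) (∣p∪q∣+∣p∩q∣≡∣p∣+∣q∣ p q) (m≤m+n _ _)

∣p∪q∣≡∣p∣+∣q∣ : ∀ {n} (p q : Subset n) → Disjoint p q → ∣ p ∪ q ∣ ≡ ∣ p ∣ + ∣ q ∣
∣p∪q∣≡∣p∣+∣q∣ {n} p q disjoint = begin
  ∣ p ∪ q ∣                ≡⟨ sym (+-identityʳ _) ⟩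
  ∣ p ∪ q ∣ + 0            ≡⟨ cong (∣ p ∪ q ∣ +_) (sym (trans (cong ∣_∣ p∩q≡∅) (∣⊥∣≡0 n))) ⟩
  ∣ p ∪ q ∣ + ∣ p ∩ q ∣    ≡⟨ ∣p∪q∣+∣p∩q∣≡∣p∣+∣q∣ p q ⟩
  ∣ p ∣ + ∣ q ∣            ∎
  where
  open ≡-Reasoning
  p∩q≡∅ : p ∩ q ≡ ∅
  p∩q≡∅ = Empty-unique λ (x , x∈p∩q) → uncurry (disjoint x) (x∈p∩q⁻ p q x∈p∩q)

p⊂p∪q : ∀ {n} {p q : Subset n} {x} → x ∈ q → x ∉ p → p ⊂ p ∪ q
p⊂p∪q {q = q} {x} x∈q x∉p = p⊆p∪q q , x , x∈p∪q⁺ (inj₂ x∈q) , x∉p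

∪-⊆ : ∀ {n} {p q r : Subset n} → p ⊆ r → q ⊆ r → p ∪ q ⊆ r
∪-⊆ {p = p} {q} p⊆r q⊆r x∈p∪q = [ p⊆r , q⊆r ]′ (x∈p∪q⁻ p q x∈p∪q)

subsetOfSize : ∀ {n} (p : Subset n) j → j ≤ ∣ p ∣ → ∃[ q ] (q ⊆ p × ∣ q ∣ ≡ j)
subsetOfSize []          zero    _       = [] , (λ ()) , refl
subsetOfSize (false ∷ p) j       j≤∣p∣   with subsetOfSize p j j≤∣p∣
... | q , q⊆p , ∣q∣≡j = false ∷ q , (λ { (there x∈q) → there (q⊆p x∈q) }) , ∣q∣≡j
subsetOfSize {n} (true ∷ p) zero _   = ∅ , ⊥⊆ , ∣⊥∣≡0 n
subsetOfSize (true ∷ p) (suc j) (s≤s j≤∣p∣) with subsetOfSize p j j≤∣p∣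
... | q , q⊆p , ∣q∣≡j = true ∷ q , (λ { here → here ; (there x∈q) → there (q⊆p x∈q) }) , cong suc ∣q∣≡j

allSubsets : ∀ n → List (Subset n)
allSubsets zero    = [] ∷ []
allSubsets (suc n) = map (true ∷_) (allSubsets n) ++ map (false ∷_) (allSubsets n)

∈-allSubsets : ∀ {n} (p : Subset n) → p List.∈ allSubsets n
∈-allSubsets []          = Any.here refl
∈-allSubsets (true  ∷ p) = ∈-++⁺ˡ (∈-map⁺ (true ∷_) (∈-allSubsets p))
∈-allSubsets (false ∷ p) = ∈-++⁺ʳ _ (∈-map⁺ (false ∷_) (∈-allSubsets p))

module _ {n : ℕ} {P Q : Subset n → Set}
         (extend : ∀ {R} → P R → Q R ⊎ ∃[ R′ ] (P R′ × R ⊂ R′)) where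

  saturate : ∀ {R} → P R → ∃[ R′ ] (P R′ × Q R′)
  saturate {R} = go R (<-wellFounded (n ∸ ∣ R ∣))
    where
    go : ∀ R → Acc _<_ (n ∸ ∣ R ∣) → P R → ∃[ R′ ] (P R′ × Q R′)
    go R (acc smaller) pR with extend pR
    ... | inj₁ qR                = R , pR , qR
    ... | inj₂ (R′ , pR′ , R⊂R′) =
      go R′ (smaller (∸-monoʳ-< (p⊂q⇒∣p∣<∣q∣ R⊂R′) (∣p∣≤n R′))) pR′

module _ {n : ℕ} (G : Graph n) where

  reach-source : ∀ {S v u} → Reach G S v u → v ∉ S
  reach-source (here v∉S)   = v∉S
  reach-source (step r _ _) = reach-source r

  reach-target : ∀ {S v u} → Reach G S v u → u ∉ S
  reach-target (here v∉S)     = v∉S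
  reach-target (step _ _ w∉S) = w∉S

  -- For A disjoint from S: A is a union of components of G - S.
  Closed : Subset n → Subset n → Set
  Closed S A = ∀ {u w} → u ∈ A → w ∉ S → adj G u w ≡ true → w ∈ A

  closed-reach : ∀ {S A v u} → Closed S A → v ∈ A → Reach G S v u → u ∈ A
  closed-reach closed v∈A (here _)           = v∈A
  closed-reach closed v∈A (step r edge w∉S) = closed (closed-reach closed v∈A r) w∉S edge

  ∪-closed : ∀ {S A B} → Closed S A → Closed S B → Closed S (A ∪ B)
  ∪-closed {A = A} {B} closedA closedB u∈A∪B w∉S edge with x∈p∪q⁻ A B u∈A∪B
  ... | inj₁ u∈A = x∈p∪q⁺ (inj₁ (closedA u∈A w∉S edge))
  ... | inj₂ u∈B = x∈p∪q⁺ (inj₂ (closedB u∈B w∉S edge))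

  reachable-closed : ∀ {S v C} → (∀ u → u ∈ C ⇔ Reach G S v u) → Closed S C
  reachable-closed spec u∈C w∉S edge = from (spec _) (step (to (spec _) u∈C) edge w∉S)

  closed-or-escape : ∀ S A →
    Closed S A ⊎ ∃[ u ] ∃[ w ] (u ∈ A × w ∉ A × w ∉ S × adj G u w ≡ true)
  closed-or-escape S A
    with any? (λ u → any? (λ w →
           u ∈? A ×-dec ¬? (w ∈? A) ×-dec ¬? (w ∈? S) ×-dec adj G u w Bool.≟ true))
  ... | yes escape = inj₂ escape
  ... | no noEscape = inj₁ closed
    where
    closed : Closed S A
    closed {u} {w} u∈A w∉S edge with w ∈? A
    ... | yes w∈A = w∈A
    ... | no  w∉A = contradiction (u , w , u∈A , w∉A , w∉S , edge) noEscape

  -- Starting from ⁅ v ⁆ ∩ ∁ S rather than ⁅ v ⁆ also covers v ∈ S, whose reachable set is empty.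
  reachableSet : ∀ S v → ∃[ C ] (∀ u → u ∈ C ⇔ Reach G S v u)
  reachableSet S v = finish (saturate extend {⁅ v ⁆ ∩ ∁ S} (source-start , reach-start))
    where
    Invariant : Subset n → Set
    Invariant R = (v ∉ S → v ∈ R) × (∀ {u} → u ∈ R → Reach G S v u)

    source-start : v ∉ S → v ∈ ⁅ v ⁆ ∩ ∁ S
    source-start v∉S = x∈p∩q⁺ (x∈⁅x⁆ v , x∉p⇒x∈∁p v∉S)

    reach-start : ∀ {u} → u ∈ ⁅ v ⁆ ∩ ∁ S → Reach G S v u
    reach-start u∈start with x∈p∩q⁻ ⁅ v ⁆ (∁ S) u∈start
    ... | u∈⁅v⁆ , u∈∁S rewrite x∈⁅y⁆⇒x≡y v u∈⁅v⁆ = here (x∈∁p⇒x∉p u∈∁S)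

    extend : ∀ {R} → Invariant R → Closed S R ⊎ ∃[ R′ ] (Invariant R′ × R ⊂ R′)
    extend {R} (source , reach) with closed-or-escape S R
    ... | inj₁ closed = inj₁ closed
    ... | inj₂ (u , w , u∈R , w∉R , w∉S , edge) =
      inj₂ (R ∪ ⁅ w ⁆ , (p⊆p∪q ⁅ w ⁆ ∘ source , reach′) , p⊂p∪q (x∈⁅x⁆ w) w∉R)
      where
      reach′ : ∀ {x} → x ∈ R ∪ ⁅ w ⁆ → Reach G S v x
      reach′ x∈R∪w with x∈p∪q⁻ R ⁅ w ⁆ x∈R∪w
      ... | inj₁ x∈R   = reach x∈R
      ... | inj₂ x∈⁅w⁆ rewrite x∈⁅y⁆⇒x≡y w x∈⁅w⁆ = step (reach u∈R) edge w∉S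

    finish : ∃[ C ] (Invariant C × Closed S C) → ∃[ C ] (∀ u → u ∈ C ⇔ Reach G S v u)
    finish (C , (source , reach) , closed) =
      C , λ u → mk⇔ reach (λ r → closed-reach closed (source (reach-source r)) r)

  IsKappa-least : ∀ {S k m} → (∀ v C → IsComponentOf G S v C → ∣ C ∣ ≤ m) → IsKappa G S k → k ≤ m
  IsKappa-least bound (_ , inj₁ (refl , _))           = z≤n
  IsKappa-least bound (_ , inj₂ (v , C , comp , refl)) = bound v C comp

  IsKappa-functional : ∀ {S k k′} → IsKappa G S k → IsKappa G S k′ → k ≡ k′
  IsKappa-functional κ κ′ = ≤-antisym (IsKappa-least (proj₁ κ′) κ) (IsKappa-least (proj₁ κ) κ′)

  kappa : ∀ S → ∃[ k ] IsKappa G S k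
  kappa S with any? (λ v → ¬? (v ∈? S))
  ... | no allInside =
    0 , (λ v _ (v∉S , _) → contradiction (v , v∉S) allInside)
      , inj₁ (refl , λ v → decidable-stable (v ∈? S) (λ v∉S → allInside (v , v∉S)))
  ... | yes (v₀ , v₀∉S) = size largest , bound , inj₂ (largest , C largest , (largest∉S , spec largest) , refl)
    where
    C : Fin n → Subset n
    C v = proj₁ (reachableSet S v)

    spec : ∀ v u → u ∈ C v ⇔ Reach G S v u
    spec v = proj₂ (reachableSet S v)

    size : Fin n → ℕ
    size v = ∣ C v ∣

    outside : List (Fin n)
    outside = filter (λ v → ¬? (v ∈? S)) (allFin n)

    largest : Fin n
    largest = argmax size v₀ outside

    largest∉S : largest ∉ S
    largest∉S = argmax-all size {P = _∉ S} v₀∉S (all-filter (λ v → ¬? (v ∈? S)) (allFin n))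

    bound : ∀ v D → IsComponentOf G S v D → ∣ D ∣ ≤ size largest
    bound v D (v∉S , specD) = ≤-trans
      (p⊆q⇒∣p∣≤∣q∣ λ u∈D → from (spec v _) (to (specD _) u∈D))
      (lookup (f[xs]≤f[argmax] {f = size} v₀ outside) (∈-filter⁺ _ (∈-allFin v) v∉S))

  integrity : ∃[ i ] IsIntegrity G i
  integrity = cost best , (best , κ best , proj₂ (kappa best) , refl) , minimal
    where
    κ : Subset n → ℕ
    κ S = proj₁ (kappa S)

    cost : Subset n → ℕ
    cost S = ∣ S ∣ + κ S

    best : Subset n
    best = argmin cost ∅ (allSubsets n)

    minimal : ∀ S k → IsKappa G S k → cost best ≤ ∣ S ∣ + k
    minimal S k κS = subst (λ k′ → cost best ≤ ∣ S ∣ + k′)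
      (IsKappa-functional (proj₂ (kappa S)) κS)
      (lookup (f[argmin]≤f[xs] {f = cost} ∅ (allSubsets n)) (∈-allSubsets S))

  Separated : Subset n → Subset n → Set
  Separated A B = Disjoint A B × NoEdgeBetween G A B

  separated? : ∀ A B → Dec (Separated A B)
  separated? A B =
    all? (λ x → x ∈? A →-dec x ∈? B →-dec no λ ())
    ×-dec all? (λ a → all? (λ b → a ∈? A →-dec b ∈? B →-dec adj G a b Bool.≟ false))

  separated-⊆ : ∀ {A B A′ B′} → A′ ⊆ A → B′ ⊆ B → Separated A B → Separated A′ B′
  separated-⊆ A′⊆A B′⊆B (disjoint , noEdge) =
    (λ x x∈A′ x∈B′ → disjoint x (A′⊆A x∈A′) (B′⊆B x∈B′)) ,
    (λ a b a∈A′ b∈B′ → noEdge a b (A′⊆A a∈A′) (B′⊆B b∈B′))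

  separated-sym : ∀ {A B} → Separated A B → Separated B A
  separated-sym (disjoint , noEdge) =
    (λ x x∈B x∈A → disjoint x x∈A x∈B) ,
    (λ b a b∈B a∈A → trans (Graph.sym G b a) (noEdge a b a∈A b∈B))

  balance : ∀ {A B} → Separated A B →
    ∃[ A′ ] ∃[ B′ ] (Separated A′ B′ × ∣ A′ ∣ ≡ ∣ A ∣ ⊓ ∣ B ∣ × ∣ B′ ∣ ≡ ∣ A ∣ ⊓ ∣ B ∣)
  balance {A} {B} sep
    with subsetOfSize A (∣ A ∣ ⊓ ∣ B ∣) (m⊓n≤m _ _) | subsetOfSize B (∣ A ∣ ⊓ ∣ B ∣) (m⊓n≤n _ _)
  ... | A′ , A′⊆A , ∣A′∣≡ | B′ , B′⊆B , ∣B′∣≡ = A′ , B′ , separated-⊆ A′⊆A B′⊆B sep , ∣A′∣≡ , ∣B′∣≡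

  IsZ-⊓ : ∀ {z A B} → IsZ G z → Separated A B → ∣ A ∣ ⊓ ∣ B ∣ ≤ z
  IsZ-⊓ (_ , maximal) sep with balance sep
  ... | A′ , B′ , (disjoint , noEdge) , ∣A′∣≡ , ∣B′∣≡ = maximal A′ B′ _ disjoint noEdge ∣A′∣≡ ∣B′∣≡

  zNumber : ∃[ z ] IsZ G z
  zNumber = value best , witness , maximal
    where
    value : Subset n × Subset n → ℕ
    value p = ∣ proj₁ p ∣ ⊓ ∣ proj₂ p ∣

    candidates : List (Subset n × Subset n)
    candidates = filter (uncurry separated?) (cartesianProduct (allSubsets n) (allSubsets n))

    best : Subset n × Subset n
    best = argmax value (∅ , ∅) candidates

    best-separated : uncurry Separated best
    best-separated = argmax-all value {P = uncurry Separated} {⊥ = ∅ , ∅}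
      ((λ _ x∈∅ _ → ∉⊥ x∈∅) , (λ _ _ a∈∅ _ → contradiction a∈∅ ∉⊥))
      (all-filter (uncurry separated?) (cartesianProduct (allSubsets n) (allSubsets n)))

    witness : ∃[ A ] ∃[ B ] (Disjoint A B × NoEdgeBetween G A B × ∣ A ∣ ≡ value best × ∣ B ∣ ≡ value best)
    witness with balance best-separated
    ... | A , B , (disjoint , noEdge) , ∣A∣≡ , ∣B∣≡ = A , B , disjoint , noEdge , ∣A∣≡ , ∣B∣≡

    maximal : ∀ A B m → Disjoint A B → NoEdgeBetween G A B → ∣ A ∣ ≡ m → ∣ B ∣ ≡ m → m ≤ value best
    maximal A B m disjoint noEdge refl ∣B∣≡m =
      subst (_≤ value best) (trans (cong (∣ A ∣ ⊓_) ∣B∣≡m) (⊓-idem _))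
        (lookup (f[xs]≤f[argmax] {f = value} (∅ , ∅) candidates)
          (∈-filter⁺ (uncurry separated?)
            (∈-cartesianProduct⁺ (∈-allSubsets A) (∈-allSubsets B)) (disjoint , noEdge)))

  separated⇒closed : ∀ {S A B} → Separated A B → (∀ {w} → w ∉ S → w ∈ A ⊎ w ∈ B) → Closed S A
  separated⇒closed (_ , noEdge) covered {u} {w} u∈A w∉S edge with covered w∉S
  ... | inj₁ w∈A = w∈A
  ... | inj₂ w∈B = contradiction (trans (sym edge) (noEdge u w u∈A w∈B)) λ ()

  separated-κ≤ : ∀ {A B k} → Separated A B → IsKappa G (∁ (A ∪ B)) k → k ≤ ∣ A ∣ ⊔ ∣ B ∣
  separated-κ≤ {A} {B} sep = IsKappa-least bound
    where
    covered : ∀ {w} → w ∉ ∁ (A ∪ B) → w ∈ A ⊎ w ∈ B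
    covered w∉S = x∈p∪q⁻ A B (x∉∁p⇒x∈p w∉S)

    bound : ∀ v C → IsComponentOf G (∁ (A ∪ B)) v C → ∣ C ∣ ≤ ∣ A ∣ ⊔ ∣ B ∣
    bound v C (v∉S , spec) with covered v∉S
    ... | inj₁ v∈A = ≤-trans
      (p⊆q⇒∣p∣≤∣q∣ λ u∈C → closed-reach (separated⇒closed sep covered) v∈A (to (spec _) u∈C))
      (m≤m⊔n _ _)
    ... | inj₂ v∈B = ≤-trans
      (p⊆q⇒∣p∣≤∣q∣ λ u∈C →
        closed-reach (separated⇒closed (separated-sym sep) (Sum.swap ∘ covered)) v∈B (to (spec _) u∈C))
      (m≤n⊔m _ _)

  integrity≤n∸z : ∀ {i z} → IsIntegrity G i → IsZ G z → i ≤ n ∸ z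
  integrity≤n∸z {i} {z} (_ , minimal) ((A , B , disjoint , noEdge , ∣A∣≡z , ∣B∣≡z) , _) = begin
    i                ≤⟨ minimal S k κS ⟩
    ∣ S ∣ + k        ≤⟨ +-monoʳ-≤ ∣ S ∣ k≤z ⟩
    ∣ S ∣ + z        ≡⟨ cong (_+ z) ∣S∣≡n∸[z+z] ⟩
    n ∸ (z + z) + z  ≡⟨ m+m≤n⇒n∸[m+m]+m≡n∸m {z} (subst (_≤ n) ∣A∪B∣≡z+z (∣p∣≤n (A ∪ B))) ⟩
    n ∸ z            ∎
    where
    open ≤-Reasoning
    S : Subset n
    S = ∁ (A ∪ B)

    k : ℕ
    k = proj₁ (kappa S)

    κS : IsKappa G S k
    κS = proj₂ (kappa S)

    ∣A∪B∣≡z+z : ∣ A ∪ B ∣ ≡ z + z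
    ∣A∪B∣≡z+z = trans (∣p∪q∣≡∣p∣+∣q∣ A B disjoint) (cong₂ _+_ ∣A∣≡z ∣B∣≡z)

    ∣S∣≡n∸[z+z] : ∣ S ∣ ≡ n ∸ (z + z)
    ∣S∣≡n∸[z+z] = trans (∣∁p∣≡n∸∣p∣ (A ∪ B)) (cong (n ∸_) ∣A∪B∣≡z+z)

    k≤z : k ≤ z
    k≤z = subst (k ≤_) (trans (cong₂ _⊔_ ∣A∣≡z ∣B∣≡z) (⊔-idem z))
      (separated-κ≤ (disjoint , noEdge) κS)

  closed-separated : ∀ {S A} → Closed S A → Separated A (∁ S ∩ ∁ A)
  closed-separated {S} {A} closed =
    (λ x x∈A x∈B → x∈∁p⇒x∉p (proj₂ (x∈p∩q⁻ (∁ S) (∁ A) x∈B)) x∈A) ,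
    (λ a b a∈A b∈B → let b∈∁S , b∈∁A = x∈p∩q⁻ (∁ S) (∁ A) b∈B in
      Bool.¬-not λ edge → x∈∁p⇒x∉p b∈∁A (closed a∈A (x∈∁p⇒x∉p b∈∁S) edge))

  balancedSplit : ∀ {S k} → IsKappa G S k →
    ∃[ A ] ∃[ B ] (Separated A B × ∣ ∁ S ∣ ≤ 2 * ∣ A ∣ + k × ∣ ∁ S ∣ ≤ 2 * ∣ B ∣ + k)
  balancedSplit {S} {k} (bound , _) = finish (saturate extend start)
    where
    Invariant : Subset n → Set
    Invariant A = Closed S A × A ⊆ ∁ S × 2 * ∣ A ∣ ≤ ∣ ∁ S ∣ + k

    start : Invariant ∅
    start = (λ u∈∅ → contradiction u∈∅ ∉⊥) , ⊥⊆
          , subst (λ c → 2 * c ≤ ∣ ∁ S ∣ + k) (sym (∣⊥∣≡0 n)) z≤n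

    addComponent : ∀ {A} → Invariant A → 2 * ∣ A ∣ + k < ∣ ∁ S ∣ → ∃[ A′ ] (Invariant A′ × A ⊂ A′)
    addComponent {A} (closed , A⊆∁S , _) notLarge with any? (λ v → v ∈? ∁ S ×-dec ¬? (v ∈? A))
    ... | no noneOutside = contradiction (p⊆q⇒∣p∣≤∣q∣ ∁S⊆A) (<⇒≱ (≤-<-trans ∣A∣≤2∣A∣+k notLarge))
      where
      ∁S⊆A : ∁ S ⊆ A
      ∁S⊆A {v} v∈∁S = decidable-stable (v ∈? A) λ v∉A → noneOutside (v , v∈∁S , v∉A)
      ∣A∣≤2∣A∣+k : ∣ A ∣ ≤ 2 * ∣ A ∣ + k
      ∣A∣≤2∣A∣+k = ≤-trans (m≤n*m ∣ A ∣ 2) (m≤m+n _ k)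
    ... | yes (v , v∈∁S , v∉A) =
      A ∪ C , (∪-closed closed (reachable-closed spec) , ∪-⊆ A⊆∁S C⊆∁S , stillSmall) ,
      p⊂p∪q (from (spec v) (here v∉S)) v∉A
      where
      v∉S : v ∉ S
      v∉S = x∈∁p⇒x∉p v∈∁S

      C : Subset n
      C = proj₁ (reachableSet S v)

      spec : ∀ u → u ∈ C ⇔ Reach G S v u
      spec = proj₂ (reachableSet S v)

      C⊆∁S : C ⊆ ∁ S
      C⊆∁S u∈C = x∉p⇒x∈∁p (reach-target (to (spec _) u∈C))

      stillSmall : 2 * ∣ A ∪ C ∣ ≤ ∣ ∁ S ∣ + k
      stillSmall = m≤n+o∧2n+o<p⇒2m≤p+o {n = ∣ A ∣}
        (≤-trans (∣p∪q∣≤∣p∣+∣q∣ A C) (+-monoʳ-≤ ∣ A ∣ (bound v C (v∉S , spec)))) notLarge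

    extend : ∀ {A} → Invariant A → ∣ ∁ S ∣ ≤ 2 * ∣ A ∣ + k ⊎ ∃[ A′ ] (Invariant A′ × A ⊂ A′)
    extend {A} inv with ∣ ∁ S ∣ ≤? 2 * ∣ A ∣ + k
    ... | yes large   = inj₁ large
    ... | no notLarge = inj₂ (addComponent inv (≰⇒> notLarge))

    finish : ∃[ A ] (Invariant A × ∣ ∁ S ∣ ≤ 2 * ∣ A ∣ + k) →
      ∃[ A ] ∃[ B ] (Separated A B × ∣ ∁ S ∣ ≤ 2 * ∣ A ∣ + k × ∣ ∁ S ∣ ≤ 2 * ∣ B ∣ + k)
    finish (A , (closed , A⊆∁S , small) , large) =
      A , ∁ S ∩ ∁ A , closed-separated closed , large ,
      m≤n+o∧2n≤m+k⇒m≤2o+k {n = ∣ A ∣} (≤-trans (p⊆q⇒∣p∣≤∣q∣ ∁S⊆A∪B) (∣p∪q∣≤∣p∣+∣q∣ A (∁ S ∩ ∁ A))) small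
      where
      ∁S⊆A∪B : ∁ S ⊆ A ∪ (∁ S ∩ ∁ A)
      ∁S⊆A∪B {x} x∈∁S with x ∈? A
      ... | yes x∈A = x∈p∪q⁺ (inj₁ x∈A)
      ... | no  x∉A = x∈p∪q⁺ (inj₂ (x∈p∩q⁺ (x∈∁S , x∉p⇒x∈∁p x∉A)))

  ∣∁S∣≤2z+κ : ∀ {S k z} → IsKappa G S k → IsZ G z → ∣ ∁ S ∣ ≤ 2 * z + k
  ∣∁S∣≤2z+κ {S} {k} {z} κS ζ = fromSplit (balancedSplit κS)
    where
    fromSplit : ∃[ A ] ∃[ B ] (Separated A B × ∣ ∁ S ∣ ≤ 2 * ∣ A ∣ + k × ∣ ∁ S ∣ ≤ 2 * ∣ B ∣ + k) →
      ∣ ∁ S ∣ ≤ 2 * z + k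
    fromSplit (A , B , sep , largeA , largeB) =
      ≤-trans (m≤2n+k∧m≤2o+k⇒m≤2[n⊓o]+k {n = ∣ A ∣} {o = ∣ B ∣} largeA largeB)
        (+-monoˡ-≤ k (*-monoʳ-≤ 2 (IsZ-⊓ ζ sep)))

  n∸2z≤∣S∣+κ : ∀ {S k z} → IsKappa G S k → IsZ G z → n ∸ 2 * z ≤ ∣ S ∣ + k
  n∸2z≤∣S∣+κ {S} {k} {z} κS ζ = m≤n+o⇒m∸n≤o n (2 * z) (begin
    n                      ≡⟨ sym (m+[n∸m]≡n (∣p∣≤n S)) ⟩
    ∣ S ∣ + (n ∸ ∣ S ∣)     ≡⟨ cong (∣ S ∣ +_) (sym (∣∁p∣≡n∸∣p∣ S)) ⟩
    ∣ S ∣ + ∣ ∁ S ∣         ≤⟨ +-monoʳ-≤ ∣ S ∣ (∣∁S∣≤2z+κ κS ζ) ⟩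
    ∣ S ∣ + (2 * z + k)     ≡⟨ x∙yz≈y∙xz ∣ S ∣ (2 * z) k ⟩
    2 * z + (∣ S ∣ + k)     ∎)
    where open ≤-Reasoning

proposition3p3 : ∀ (n : ℕ) (G : Graph n) →
    ∃[ i ] ∃[ z ] (IsIntegrity G i × IsZ G z × n ∸ 2 * z ≤ i × i ≤ n ∸ z)
proposition3p3 n G with integrity G | zNumber G
... | i , ι@((S , k , κS , refl) , _) | z , ζ =
  i , z , ι , ζ , n∸2z≤∣S∣+κ G κS ζ , integrity≤n∸z G ι ζ
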